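{- For every integer $x$ and every odd natural number $n \geq 5$, if $x^2 + 7 = 2^n$, then $n - 2 \equiv 3$, $5$, or $13 \pmod{42}$. -}

module Defs where

-- In ℤ[ω], ω = (1 + √−7)/2, the prime 2 splits as ωω̄ with ω, ω̄ coprime, and N(a + bω) =
-- a² + ab + 2b². A solution x = 2p + 1 gives N(p + ω) = (x² + 7)/4 = 2ⁿ⁻² with p + ω not
-- divisible by 2, so p + ω is ±ωⁿ⁻² or ±ω̄ⁿ⁻²: an element of norm 2ᵏ⁺¹ is divisible by ω or
-- by ω̄, dividing halves the norm, and it cannot pick up both factors. Comparing ω-coefficients,
-- Bₙ₋₂ = ±1 where ωᵏ = Aₖ + Bₖω. Modulo 8, Bₖ ≡ −1 for odd k ≥ 3, which excludes +1; modulo 7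
-- the sequence ωᵏ has period 42, and a finite check of Bᵣ ≡ −1 (mod 7) for odd r < 42 leaves
-- r = 3, 5, 13.
module Submission where

open import Defs
open import Data.Nat using (ℕ; _≤_; _∸_; _^_; _%_)
open import Data.Integer using (ℤ; +_; _+_; _*_)
open import Data.Sum using (_⊎_)
open import Relation.Binary.PropositionalEquality using (_≡_)

open import Data.Nat as ℕ using (zero; suc; s≤s; _/_)
import Data.Nat.Properties as ℕ
import Data.Nat.DivMod as ℕ
import Data.Nat.Divisibility as ℕ
open import Data.Nat.Primality using (euclidsLemma; prime[2])
open import Data.Integer using (-_; _-_; ∣_∣; -1ℤ; -[1+_])
open import Data.Integer.Properties
  using (*-comm; +-identityˡ; +-identityʳ; +-injective; pos-+; pos-*; abs-*; neg-involutive;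
         *-cancelˡ-≡; ∣i∣≡0⇒i≡0)
open import Data.Integer.Divisibility.Signed
  using (_∣_; divides; _∣?_; ∣-refl; ∣ᵤ⇒∣; ∣⇒∣ᵤ; ∣m∣n⇒∣m+n; ∣m⇒∣-m; ∣n⇒∣m*n; ∣m⇒∣m*n;
         ∣m+n∣m⇒∣n; ∣m+n∣n⇒∣m)
open import Data.Integer.DivMod using (_%ℕ_; _/ℕ_; n%ℕd<d; a≡a%ℕn+[a/ℕn]*n)
open import Data.Integer.Tactic.RingSolver using (solve-∀)
import Data.Nat.Tactic.RingSolver as ℕ-Solver
open import Data.Product using (_×_; _,_; proj₁; proj₂; ∃; uncurry)
open import Data.Sum as Sum using (inj₁; inj₂)
open import Function using (_∘_)
open import Relation.Nullary using (¬_; Dec; contradiction)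
open import Relation.Nullary.Decidable using (map′; from-yes; from-no; _×-dec_; _→-dec_; _⊎-dec_)
open import Relation.Binary.PropositionalEquality
  using (refl; sym; trans; cong; cong₂; subst; subst₂; module ≡-Reasoning)

u²+7v²≡4 : ∀ u v → u ℕ.* u ℕ.+ 7 ℕ.* (v ℕ.* v) ≡ 4 → v ≡ 0 × u ≡ 2
u²+7v²≡4 2 0 _ = refl , refl
u²+7v²≡4 (suc (suc (suc u))) 0 eq = contradiction (sym eq) (ℕ.<⇒≢ (ℕ.≤-trans 4<9 9≤u²))
  where
  4<9 : 4 ℕ.< 9
  4<9 = from-yes (4 ℕ.<? 9)
  9≤u² : 9 ≤ (3 ℕ.+ u) ℕ.* (3 ℕ.+ u) ℕ.+ 0
  9≤u² = ℕ.≤-trans (ℕ.*-mono-≤ (ℕ.m≤m+n 3 u) (ℕ.m≤m+n 3 u)) (ℕ.m≤m+n _ 0)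
u²+7v²≡4 u (suc v) eq = contradiction (sym eq) (ℕ.<⇒≢ (ℕ.≤-trans 4<7 7≤7v²))
  where
  4<7 : 4 ℕ.< 7
  4<7 = from-yes (4 ℕ.<? 7)
  7≤7v² : 7 ≤ u ℕ.* u ℕ.+ 7 ℕ.* (suc v ℕ.* suc v)
  7≤7v² = ℕ.≤-trans (ℕ.m≤m*n 7 (suc v ℕ.* suc v)) (ℕ.m≤n+m _ (u ℕ.* u))

square-abs : ∀ x → x * x ≡ + (∣ x ∣ ℕ.* ∣ x ∣)
square-abs (+ n) = sym (pos-* n n)
square-abs -[1+ n ] = refl

2∣*⇒2∣⊎2∣ : ∀ x y → + 2 ∣ x * y → (+ 2 ∣ x) ⊎ (+ 2 ∣ y)
2∣*⇒2∣⊎2∣ x y 2∣xy =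
  Sum.map ∣ᵤ⇒∣ ∣ᵤ⇒∣ (euclidsLemma ∣ x ∣ ∣ y ∣ prime[2] (subst (2 ℕ.∣_) (abs-* x y) (∣⇒∣ᵤ 2∣xy)))

parity : ∀ x → (+ 2 ∣ x) ⊎ ∃ λ p → x ≡ + 1 + p * + 2
parity x with x %ℕ 2 | n%ℕd<d x 2 | a≡a%ℕn+[a/ℕn]*n x 2
... | 0 | _ | x≡0+q*2 = inj₁ (divides (x /ℕ 2) (trans x≡0+q*2 (+-identityˡ _)))
... | 1 | _ | x≡1+q*2 = inj₂ (x /ℕ 2 , x≡1+q*2)
... | suc (suc _) | s≤s (s≤s ()) | _

2∣2^suc : ∀ k → + 2 ∣ + (2 ^ suc k)
2∣2^suc k = divides (+ (2 ^ k)) (trans (pos-* 2 (2 ^ k)) (*-comm (+ 2) (+ (2 ^ k))))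

odd⇒3+t*2 : ∀ m → m % 2 ≡ 1 → 3 ≤ m → ∃ λ t → m ≡ 3 ℕ.+ t ℕ.* 2
odd⇒3+t*2 m m-odd 3≤m with m / 2 | ℕ.m≡m%n+[m/n]*n m 2
... | zero | m≡m%2+0 =
  contradiction (subst (3 ≤_) (trans m≡m%2+0 (cong (ℕ._+ 0) m-odd)) 3≤m) λ { (s≤s ()) }
... | suc t | m≡m%2+[1+t]*2 = t , trans m≡m%2+[1+t]*2 (cong (ℕ._+ suc t ℕ.* 2) m-odd)

-- (a , b) stands for a + bω, where ω² = ω − 2.
ℤ[ω] : Set
ℤ[ω] = ℤ × ℤ

re im : ℤ[ω] → ℤ
re = proj₁
im = proj₂

N : ℤ[ω] → ℤ
N (a , b) = a * a + a * b + + 2 * (b * b)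

neg conj ω·_ : ℤ[ω] → ℤ[ω]
neg (a , b) = - a , - b
conj (a , b) = a + b , - b
ω· (a , b) = - (+ 2 * b) , a + b

ω^_ : ℕ → ℤ[ω]
ω^ zero = + 1 , + 0
ω^ suc k = ω· (ω^ k)

N-ω· : ∀ z → N (ω· z) ≡ + 2 * N z
N-ω· (a , b) = identity a b
  where
  identity : ∀ a b → - (+ 2 * b) * - (+ 2 * b) + - (+ 2 * b) * (a + b) + + 2 * ((a + b) * (a + b))
                   ≡ + 2 * (a * a + a * b + + 2 * (b * b))
  identity = solve-∀

N-conj : ∀ z → N (conj z) ≡ N z
N-conj (a , b) = identity a b
  where
  identity : ∀ a b → (a + b) * (a + b) + (a + b) * - b + + 2 * (- b * - b)
                   ≡ a * a + a * b + + 2 * (b * b)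
  identity = solve-∀

N≡re*re-conj+2im² : ∀ z → N z ≡ re z * re (conj z) + + 2 * (im z * im z)
N≡re*re-conj+2im² (a , b) = identity a b
  where
  identity : ∀ a b → a * a + a * b + + 2 * (b * b) ≡ a * (a + b) + + 2 * (b * b)
  identity = solve-∀

conj-involutive : ∀ z → conj (conj z) ≡ z
conj-involutive (a , b) = cong₂ _,_ (identity a b) (neg-involutive b)
  where
  identity : ∀ a b → a + b + - b ≡ a
  identity = solve-∀

conj-neg : ∀ z → conj (neg z) ≡ neg (conj z)
conj-neg (a , b) = cong (_, - - b) (identity a b)
  where
  identity : ∀ a b → - a + - b ≡ - (a + b)
  identity = solve-∀

ω·-neg : ∀ z → ω· (neg z) ≡ neg (ω· z)
ω·-neg (a , b) = cong₂ _,_ (identity₁ b) (identity₂ a b)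
  where
  identity₁ : ∀ b → - (+ 2 * - b) ≡ - - (+ 2 * b)
  identity₁ = solve-∀
  identity₂ : ∀ a b → - a + - b ≡ - (a + b)
  identity₂ = solve-∀

2∣_ : ℤ[ω] → Set
2∣ z = (+ 2 ∣ re z) × (+ 2 ∣ im z)

Primitive : ℤ[ω] → Set
Primitive z = ¬ 2∣ z

2∣-neg : ∀ {z} → 2∣ z → 2∣ neg z
2∣-neg (2∣a , 2∣b) = ∣m⇒∣-m 2∣a , ∣m⇒∣-m 2∣b

2∣-ω· : ∀ {z} → 2∣ z → 2∣ ω· z
2∣-ω· {a , b} (2∣a , 2∣b) = ∣m⇒∣-m (∣n⇒∣m*n (+ 2) 2∣b) , ∣m∣n⇒∣m+n 2∣a 2∣b

2∣-conj : ∀ {z} → 2∣ conj z → 2∣ z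
2∣-conj {a , b} (2∣a+b , 2∣-b) = ∣m+n∣n⇒∣m 2∣a+b 2∣b , 2∣b
  where
  2∣b : + 2 ∣ b
  2∣b = subst (+ 2 ∣_) (neg-involutive b) (∣m⇒∣-m 2∣-b)

-- ω · ω̄ · z̄ = 2 z̄
2∣ω·conj-ω· : ∀ z → 2∣ ω· (conj (ω· z))
2∣ω·conj-ω· (a , b) = divides (a + b) (identity₁ a b) , divides (- b) (identity₂ a b)
  where
  identity₁ : ∀ a b → - (+ 2 * - (a + b)) ≡ (a + b) * + 2
  identity₁ = solve-∀
  identity₂ : ∀ a b → - (+ 2 * b) + (a + b) + - (a + b) ≡ - b * + 2
  identity₂ = solve-∀

2∣re⇒ω-divides : ∀ z → + 2 ∣ re z → ∃ λ w → z ≡ ω· w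
2∣re⇒ω-divides (a , b) (divides p a≡p*2) =
  (b + p , - p) , cong₂ _,_ (trans a≡p*2 (identity₁ p)) (identity₂ b p)
  where
  identity₁ : ∀ p → p * + 2 ≡ - (+ 2 * - p)
  identity₁ = solve-∀
  identity₂ : ∀ b p → b ≡ b + p + - p
  identity₂ = solve-∀

data SignConjugate (w : ℤ[ω]) : ℤ[ω] → Set where
  same          : SignConjugate w w
  negated       : SignConjugate w (neg w)
  conjugated    : SignConjugate w (conj w)
  negConjugated : SignConjugate w (neg (conj w))

SignConjugate-conj : ∀ {w z} → SignConjugate w z → SignConjugate w (conj z)
SignConjugate-conj same = conjugated
SignConjugate-conj {w} negated = subst (SignConjugate w) (sym (conj-neg w)) negConjugated
SignConjugate-conj {w} conjugated = subst (SignConjugate w) (sym (conj-involutive w)) same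
SignConjugate-conj {w} negConjugated =
  subst (SignConjugate w) (sym (trans (conj-neg (conj w)) (cong neg (conj-involutive w)))) negated

SignConjugate-im : ∀ {w z} → SignConjugate w z → im w ≡ im z ⊎ im w ≡ - im z
SignConjugate-im same = inj₁ refl
SignConjugate-im {w} negated = inj₂ (sym (neg-involutive (im w)))
SignConjugate-im {w} conjugated = inj₂ (sym (neg-involutive (im w)))
SignConjugate-im {w} negConjugated = inj₁ (sym (neg-involutive (im w)))

-- ω̄⁰ = ω⁰, while for k > 0 the product ω · ω̄ᵏ is divisible by ωω̄ = 2.
ω·-SignConjugate : ∀ k {z} → SignConjugate (ω^ k) z → Primitive (ω· z) →
  SignConjugate (ω^ suc k) (ω· z)
ω·-SignConjugate k same _ = same
ω·-SignConjugate k negated _ = subst (SignConjugate (ω^ suc k)) (sym (ω·-neg (ω^ k))) negated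
ω·-SignConjugate zero conjugated _ = same
ω·-SignConjugate zero negConjugated _ = negated
ω·-SignConjugate (suc k) conjugated prim = contradiction (2∣ω·conj-ω· (ω^ k)) prim
ω·-SignConjugate (suc k) negConjugated prim =
  contradiction (subst 2∣_ (sym (ω·-neg (conj (ω^ suc k)))) (2∣-neg (2∣ω·conj-ω· (ω^ k)))) prim

∣a∣≡1⇒±1 : ∀ a → ∣ a ∣ ≡ 1 → SignConjugate (ω^ 0) (a , + 0)
∣a∣≡1⇒±1 (+ 1) _ = same
∣a∣≡1⇒±1 -[1+ 0 ] _ = negated
∣a∣≡1⇒±1 (+ 0) ()
∣a∣≡1⇒±1 (+ suc (suc _)) ()
∣a∣≡1⇒±1 -[1+ suc _ ] ()

N≡1⇒±1 : ∀ z → N z ≡ + 1 → SignConjugate (ω^ 0) z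
N≡1⇒±1 (a , b) N≡1 with u²+7v²≡4 ∣ c ∣ ∣ b ∣ ∣c∣²+7∣b∣²≡4
  where
  c : ℤ
  c = + 2 * a + b
  4N≡c²+7b² : ∀ a b → + 4 * (a * a + a * b + + 2 * (b * b))
                     ≡ (+ 2 * a + b) * (+ 2 * a + b) + + 7 * (b * b)
  4N≡c²+7b² = solve-∀
  ∣c∣² ∣b∣² : ℕ
  ∣c∣² = ∣ c ∣ ℕ.* ∣ c ∣
  ∣b∣² = ∣ b ∣ ℕ.* ∣ b ∣
  ∣c∣²+7∣b∣²≡4 : ∣c∣² ℕ.+ 7 ℕ.* ∣b∣² ≡ 4
  ∣c∣²+7∣b∣²≡4 = +-injective (begin
    + (∣c∣² ℕ.+ 7 ℕ.* ∣b∣²)   ≡⟨ pos-+ ∣c∣² (7 ℕ.* ∣b∣²) ⟩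
    + ∣c∣² + + (7 ℕ.* ∣b∣²)   ≡⟨ cong (λ b² → + ∣c∣² + b²) (pos-* 7 ∣b∣²) ⟩
    + ∣c∣² + + 7 * + ∣b∣²     ≡⟨ cong₂ (λ c² b² → c² + + 7 * b²) (square-abs c) (square-abs b) ⟨
    c * c + + 7 * (b * b)     ≡⟨ 4N≡c²+7b² a b ⟨
    + 4 * N (a , b)           ≡⟨ cong (+ 4 *_) N≡1 ⟩
    + 4                       ∎)
    where open ≡-Reasoning
... | ∣b∣≡0 , ∣2a+b∣≡2 with ∣i∣≡0⇒i≡0 {b} ∣b∣≡0
... | refl = ∣a∣≡1⇒±1 a (ℕ.*-cancelˡ-≡ ∣ a ∣ 1 2 2∣a∣≡2)
  where
  2∣a∣≡2 : 2 ℕ.* ∣ a ∣ ≡ 2 ℕ.* 1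
  2∣a∣≡2 = trans (sym (abs-* (+ 2) a)) (trans (cong ∣_∣ (sym (+-identityʳ (+ 2 * a)))) ∣2a+b∣≡2)

2∣N⇒2∣re⊎2∣re-conj : ∀ z → + 2 ∣ N z → (+ 2 ∣ re z) ⊎ (+ 2 ∣ re (conj z))
2∣N⇒2∣re⊎2∣re-conj z 2∣N =
  2∣*⇒2∣⊎2∣ (re z) (re (conj z)) (∣m+n∣n⇒∣m 2∣N′ (∣m⇒∣m*n (im z * im z) ∣-refl))
  where
  2∣N′ : + 2 ∣ re z * re (conj z) + + 2 * (im z * im z)
  2∣N′ = subst (+ 2 ∣_) (N≡re*re-conj+2im² z) 2∣N

ω-divisible-norm-2^ : ∀ k → (∀ z → N z ≡ + (2 ^ k) → Primitive z → SignConjugate (ω^ k) z) →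
  ∀ w → N w ≡ + (2 ^ suc k) → Primitive w → + 2 ∣ re w → SignConjugate (ω^ suc k) w
ω-divisible-norm-2^ k norm-2^k w N≡2^k+1 prim 2∣a with 2∣re⇒ω-divides w 2∣a
... | w′ , refl = ω·-SignConjugate k (norm-2^k w′ N≡2^k (prim ∘ 2∣-ω·)) prim
  where
  N≡2^k : N w′ ≡ + (2 ^ k)
  N≡2^k = *-cancelˡ-≡ (+ 2) _ _ (trans (sym (N-ω· w′)) (trans N≡2^k+1 (pos-* 2 (2 ^ k))))

primitive-norm-2^ : ∀ k z → N z ≡ + (2 ^ k) → Primitive z → SignConjugate (ω^ k) z
primitive-norm-2^ zero z N≡1 _ = N≡1⇒±1 z N≡1
primitive-norm-2^ (suc k) z N≡2^k+1 prim with 2∣N⇒2∣re⊎2∣re-conj z 2∣N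
  where
  2∣N : + 2 ∣ N z
  2∣N = subst (+ 2 ∣_) (sym N≡2^k+1) (2∣2^suc k)
... | inj₁ 2∣a = ω-divisible-norm-2^ k (primitive-norm-2^ k) z N≡2^k+1 prim 2∣a
... | inj₂ 2∣a+b = subst (SignConjugate (ω^ suc k)) (conj-involutive z) (SignConjugate-conj
  (ω-divisible-norm-2^ k (primitive-norm-2^ k) (conj z) (trans (N-conj z) N≡2^k+1) (prim ∘ 2∣-conj) 2∣a+b))

infix 4 _≈_mod_ _≈?_mod_

record _≈_mod_ (z w : ℤ[ω]) (q : ℤ) : Set where
  constructor _,_
  field
    re-≈ : q ∣ re z - re w
    im-≈ : q ∣ im z - im w

open _≈_mod_ using (im-≈)

_≈?_mod_ : ∀ z w q → Dec (z ≈ w mod q)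
z ≈? w mod q =
  map′ (uncurry _,_) (λ (q∣a , q∣b) → q∣a , q∣b) ((q ∣? re z - re w) ×-dec (q ∣? im z - im w))

module _ {q : ℤ} where

  ∣x-x : ∀ x → q ∣ x - x
  ∣x-x x = divides (+ 0) (identity x q)
    where
    identity : ∀ x q → x - x ≡ + 0 * q
    identity = solve-∀

  ∣x-y⇒∣y-x : ∀ x y → q ∣ x - y → q ∣ y - x
  ∣x-y⇒∣y-x x y q∣x-y = subst (q ∣_) (identity x y) (∣m⇒∣-m q∣x-y)
    where
    identity : ∀ x y → - (x - y) ≡ y - x
    identity = solve-∀

  ∣x-y⇒∣y-z⇒∣x-z : ∀ x y z → q ∣ x - y → q ∣ y - z → q ∣ x - z
  ∣x-y⇒∣y-z⇒∣x-z x y z q∣x-y q∣y-z = subst (q ∣_) (identity x y z) (∣m∣n⇒∣m+n q∣x-y q∣y-z)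
    where
    identity : ∀ x y z → x - y + (y - z) ≡ x - z
    identity = solve-∀

  ≈-refl : ∀ {z} → z ≈ z mod q
  ≈-refl {a , b} = ∣x-x a , ∣x-x b

  ≈-sym : ∀ {z w} → z ≈ w mod q → w ≈ z mod q
  ≈-sym {a , b} {c , d} (q∣a-c , q∣b-d) = ∣x-y⇒∣y-x a c q∣a-c , ∣x-y⇒∣y-x b d q∣b-d

  ≈-trans : ∀ {z w v} → z ≈ w mod q → w ≈ v mod q → z ≈ v mod q
  ≈-trans {a , b} {c , d} {e , f} (q∣a-c , q∣b-d) (q∣c-e , q∣d-f) =
    ∣x-y⇒∣y-z⇒∣x-z a c e q∣a-c q∣c-e , ∣x-y⇒∣y-z⇒∣x-z b d f q∣b-d q∣d-f

  ω·-cong : ∀ {z w} → z ≈ w mod q → ω· z ≈ ω· w mod q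
  ω·-cong {a , b} {c , d} (q∣a-c , q∣b-d) =
    subst (q ∣_) (identity₁ b d) (∣n⇒∣m*n (- + 2) q∣b-d) ,
    subst (q ∣_) (identity₂ a b c d) (∣m∣n⇒∣m+n q∣a-c q∣b-d)
    where
    identity₁ : ∀ b d → - + 2 * (b - d) ≡ - (+ 2 * b) - - (+ 2 * d)
    identity₁ = solve-∀
    identity₂ : ∀ a b c d → a - c + (b - d) ≡ a + b - (c + d)
    identity₂ = solve-∀

  ω^-shift : ∀ {k P} → ω^ (k ℕ.+ P) ≈ ω^ k mod q → ∀ j → ω^ (j ℕ.+ (k ℕ.+ P)) ≈ ω^ (j ℕ.+ k) mod q
  ω^-shift period zero = period
  ω^-shift period (suc j) = ω·-cong (ω^-shift period j)

  ω^-periodic : ∀ {k P} → ω^ (k ℕ.+ P) ≈ ω^ k mod q →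
    ∀ j t → ω^ (k ℕ.+ j ℕ.+ t ℕ.* P) ≈ ω^ (k ℕ.+ j) mod q
  ω^-periodic {k} period j zero =
    subst (λ i → ω^ i ≈ ω^ (k ℕ.+ j) mod q) (sym (ℕ.+-identityʳ (k ℕ.+ j))) ≈-refl
  ω^-periodic {k} {P} period j (suc t) = ≈-trans one-period (ω^-periodic period j t)
    where
    one-period : ω^ (k ℕ.+ j ℕ.+ (P ℕ.+ t ℕ.* P)) ≈ ω^ (k ℕ.+ j ℕ.+ t ℕ.* P) mod q
    one-period = subst₂ (λ z w → z ≈ w mod q)
      (cong ω^_ (identity₁ k j t P)) (cong ω^_ (identity₂ k j t P)) (ω^-shift period (j ℕ.+ t ℕ.* P))
      where
      identity₁ : ∀ k j t P → j ℕ.+ t ℕ.* P ℕ.+ (k ℕ.+ P) ≡ k ℕ.+ j ℕ.+ (P ℕ.+ t ℕ.* P)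
      identity₁ = ℕ-Solver.solve-∀
      identity₂ : ∀ k j t P → j ℕ.+ t ℕ.* P ℕ.+ k ≡ k ℕ.+ j ℕ.+ t ℕ.* P
      identity₂ = ℕ-Solver.solve-∀

ω^5≈ω^3-mod-8 : ω^ (3 ℕ.+ 2) ≈ ω^ 3 mod + 8
ω^5≈ω^3-mod-8 = from-yes (ω^ 5 ≈? ω^ 3 mod + 8)

ω^42≈1-mod-7 : ω^ (0 ℕ.+ 42) ≈ ω^ 0 mod + 7
ω^42≈1-mod-7 = from-yes (ω^ 42 ≈? ω^ 0 mod + 7)

im-ω^-odd-mod-8 : ∀ m → m % 2 ≡ 1 → 3 ≤ m → + 8 ∣ im (ω^ m) + + 1
im-ω^-odd-mod-8 m m-odd 3≤m with odd⇒3+t*2 m m-odd 3≤m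
... | t , refl = im-≈ (ω^-periodic {k = 3} {P = 2} ω^5≈ω^3-mod-8 0 t)

Residue : ℕ → Set
Residue r = r % 2 ≡ 1 → + 7 ∣ im (ω^ r) + + 1 → r ≡ 3 ⊎ r ≡ 5 ⊎ r ≡ 13

residue? : ∀ r → Dec (Residue r)
residue? r =
  (r % 2 ℕ.≟ 1) →-dec (+ 7 ∣? im (ω^ r) + + 1) →-dec (r ℕ.≟ 3 ⊎-dec r ℕ.≟ 5 ⊎-dec r ℕ.≟ 13)

residues-below-42 : ∀ {r} → r ℕ.< 42 → Residue r
residues-below-42 = from-yes (ℕ.allUpTo? residue? 42)

im-ω^≡-1⇒residue : ∀ m → m % 2 ≡ 1 → im (ω^ m) ≡ -1ℤ → m % 42 ≡ 3 ⊎ m % 42 ≡ 5 ⊎ m % 42 ≡ 13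
im-ω^≡-1⇒residue m m-odd B≡-1 = residues-below-42 (ℕ.m%n<n m 42) r-odd 7∣B+1
  where
  r-odd : m % 42 % 2 ≡ 1
  r-odd = trans (ℕ.m∣n⇒o%n%m≡o%m 2 42 m (ℕ.divides 21 refl)) m-odd
  ω^m≈ω^r : ω^ m ≈ ω^ (m % 42) mod + 7
  ω^m≈ω^r = subst (λ i → ω^ i ≈ ω^ (m % 42) mod + 7) (sym (ℕ.m≡m%n+[m/n]*n m 42))
    (ω^-periodic ω^42≈1-mod-7 (m % 42) (m / 42))
  7∣B+1 : + 7 ∣ im (ω^ (m % 42)) + + 1
  7∣B+1 = subst (λ b → + 7 ∣ im (ω^ (m % 42)) - b) B≡-1 (im-≈ (≈-sym ω^m≈ω^r))

im-ω^≡±1⇒residue : ∀ m → m % 2 ≡ 1 → 3 ≤ m → im (ω^ m) ≡ + 1 ⊎ im (ω^ m) ≡ -1ℤ →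
  m % 42 ≡ 3 ⊎ m % 42 ≡ 5 ⊎ m % 42 ≡ 13
im-ω^≡±1⇒residue m m-odd 3≤m (inj₁ B≡1) =
  contradiction (subst (λ b → + 8 ∣ b + + 1) B≡1 (im-ω^-odd-mod-8 m m-odd 3≤m))
                (from-no (+ 8 ∣? + 2))
im-ω^≡±1⇒residue m m-odd _ (inj₂ B≡-1) = im-ω^≡-1⇒residue m m-odd B≡-1

solution⇒im-ω^≡±1 : ∀ x m → x * x + + 7 ≡ + (2 ^ (2 ℕ.+ m)) → im (ω^ m) ≡ + 1 ⊎ im (ω^ m) ≡ -1ℤ
solution⇒im-ω^≡±1 x m x²+7≡2ⁿ with parity x
... | inj₁ 2∣x = contradiction (∣m+n∣m⇒∣n 2∣x²+7 (∣m⇒∣m*n x 2∣x)) (from-no (+ 2 ∣? + 7))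
  where
  2∣x²+7 : + 2 ∣ x * x + + 7
  2∣x²+7 = subst (+ 2 ∣_) (sym x²+7≡2ⁿ) (2∣2^suc (1 ℕ.+ m))
... | inj₂ (p , refl) = SignConjugate-im (primitive-norm-2^ m (p , + 1) N≡2^m p+ω-primitive)
  where
  4N≡x²+7 : ∀ p → + 4 * (p * p + p * + 1 + + 2 * (+ 1 * + 1)) ≡ (+ 1 + p * + 2) * (+ 1 + p * + 2) + + 7
  4N≡x²+7 = solve-∀
  N≡2^m : N (p , + 1) ≡ + (2 ^ m)
  N≡2^m = *-cancelˡ-≡ (+ 4) _ _ (begin
    + 4 * N (p , + 1)                        ≡⟨ 4N≡x²+7 p ⟩
    (+ 1 + p * + 2) * (+ 1 + p * + 2) + + 7  ≡⟨ x²+7≡2ⁿ ⟩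
    + (2 ℕ.* (2 ℕ.* 2 ^ m))                  ≡⟨ cong +_ (ℕ.*-assoc 2 2 (2 ^ m)) ⟨
    + (4 ℕ.* 2 ^ m)                          ≡⟨ pos-* 4 (2 ^ m) ⟩
    + 4 * + (2 ^ m)                          ∎)
    where open ≡-Reasoning
  p+ω-primitive : Primitive (p , + 1)
  p+ω-primitive (_ , 2∣1) = from-no (+ 2 ∣? + 1) 2∣1

mainTheorem3 : (x : ℤ) (n : ℕ) → n % 2 ≡ 1 → 5 ≤ n → x * x + + 7 ≡ + (2 ^ n) →
    ((n ∸ 2) % 42 ≡ 3) ⊎ ((n ∸ 2) % 42 ≡ 5) ⊎ ((n ∸ 2) % 42 ≡ 13)
mainTheorem3 x (suc (suc m)) n-odd (s≤s (s≤s 3≤m)) x²+7≡2ⁿ =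
  im-ω^≡±1⇒residue m m-odd 3≤m (solution⇒im-ω^≡±1 x m x²+7≡2ⁿ)
  where
  m-odd : m % 2 ≡ 1
  m-odd = trans (sym (ℕ.[m+n]%n≡m%n m 2)) (trans (cong (_% 2) (ℕ.+-comm m 2)) n-odd)
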